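{- Let $X$ be a non-empty universe with a binary, symmetric, anti-reflexive relation $\wr$, and let $A, B \in \mathrm{Disc}$. Then there are no $x, y \in (A \odot B)^2$ such that $x \wr y$ and $x \in (A \odot B)^1$ (with $y \in (A \odot B)^2$).
   Context: A negotiation set on a non-empty universe $X$ is an ordered pair $A=[A^1, A^2]$ with $A^1 \subseteq A^2 \subseteq X$. For negotiation sets $A, B$, the operation $\odot$ is defined by $A \odot B = [A^1 \cap B^1,\ A^2 \cup B^2]$. Given two binary, symmetric, anti-reflexive relations on $X$, $\mathrel{S}$ ("strong contradiction") and $\wr$ ("weak contradiction"), the class $\mathrm{Disc}$ consists of those negotiation sets $A$ such that (1) there are no $x, y \in A^2$ with $x \mathrel{S} y$, and (2) there are no $x, y \in A^2$ with $x \wr y$ and ($x \in A^1$ or $y \in A^1$). -}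

module Defs where

open import Level using (0ℓ)
open import Data.Product using (_×_; _,_; ∃-syntax)
open import Data.Sum using (_⊎_; inj₁)
open import Relation.Nullary using (¬_)
open import Relation.Unary using (Pred; _⊆_; _∩_; _∪_; _∈_)
open import Relation.Binary using (Rel)

-- A negotiation set on universe X: a pair [A¹, A²] with A¹ ⊆ A² ⊆ X.
record NegSet (X : Set) : Set₁ where
  field
    one : Pred X 0ℓ
    two : Pred X 0ℓ
    one⊆two : one ⊆ two
open NegSet public

_⊙_ : {X : Set} → NegSet X → NegSet X → NegSet X
A ⊙ B = record
  { one = one A ∩ one B
  ; two = two A ∪ two B
  ; one⊆two = λ { (a , _) → inj₁ (one⊆two A a) } }

-- Disc with respect to strong contradiction S and weak contradiction W (≀)
Disc : {X : Set} → Rel X 0ℓ → Rel X 0ℓ → NegSet X → Set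
Disc {X} S W A =
  (¬ (∃[ x ] ∃[ y ] (x ∈ two A × y ∈ two A × S x y)))
  × (¬ (∃[ x ] ∃[ y ] (x ∈ two A × y ∈ two A × W x y × (x ∈ one A ⊎ y ∈ one A))))

module Submission where

open import Defs
open import Level using (0ℓ)
open import Data.Product using (_×_; ∃-syntax; _,_)
open import Data.Sum using (inj₁; inj₂)
open import Relation.Nullary using (¬_)
open import Relation.Unary using (_∈_)
open import Relation.Binary using (Rel; Symmetric; Irreflexive)
open import Relation.Binary.PropositionalEquality using (_≡_)

Disc⇒¬weak-one-two : {X : Set} {S W : Rel X 0ℓ} (A : NegSet X) → Disc S W A
  → ∀ {x y} → x ∈ one A → y ∈ two A → ¬ W x y
Disc⇒¬weak-one-two A (_ , noWeak) {x} {y} x∈A¹ y∈A² w =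
  noWeak (x , y , one⊆two A x∈A¹ , y∈A² , w , inj₁ x∈A¹)

mainTheorem9 : {X : Set} → X → (S W : Rel X 0ℓ)
    → Symmetric S → Irreflexive _≡_ S → Symmetric W → Irreflexive _≡_ W
    → (A B : NegSet X) → Disc S W A → Disc S W B
    → ¬ (∃[ x ] ∃[ y ] (x ∈ two (A ⊙ B) × y ∈ two (A ⊙ B) × W x y × x ∈ one (A ⊙ B)))
mainTheorem9 _ S W _ _ _ _ A B discA discB (x , y , _ , inj₁ y∈A² , w , x∈A¹ , _) =
  Disc⇒¬weak-one-two A discA x∈A¹ y∈A² w
mainTheorem9 _ S W _ _ _ _ A B discA discB (x , y , _ , inj₂ y∈B² , w , _ , x∈B¹) =
  Disc⇒¬weak-one-two B discB x∈B¹ y∈B² w
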